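{- Let $a$ be a constant and let $P$ be the program consisting of the rules (1)–(9) listed in the context together with the fact $act(a).$ Then the answer sets of $P$, restricted to literals over the predicates $O$, $F$, $Do$ (i.e. disregarding the auxiliary predicates $Dia$, $Happens$, $act$), are exactly the maximal consistent sets of deontic literals for $a$, namely $\{O(a),-F(a),Do(a)\}$, $\{F(a),-O(a),-Do(a)\}$, $\{ -F(a),-O(a),-Do(a)\}$, $\{ -F(a),-O(a),Do(a)\}$; i.e. every answer set of $P$ restricts to one of these four sets, and each of these four sets is the restriction of some answer set of $P$.
   Context: Programs are finite sets of rules $H_1\lor\dots\lor H_l \mathop{{:}- } A_1,\dots,A_n,\ \textit{not } B_1,\dots,\textit{not } B_m$ ($l,m,n\ge 0$) over literals (atoms or strongly negated atoms $-p$); rules with $l=0$ are constraints. For a ground program $\Pi$ and a consistent set $S$ of ground literals (not containing both $p$ and $-p$), $S\models B(r)$ means $\{A_1,\dots,A_n\}\subseteq S$ and $\{B_1,\dots,B_m\}\cap S=\emptyset$; $S\models H(r)$ means $\{H_1,\dots,H_l\}\cap S\ne\emptyset$ (never true for a constraint); $S\models r$ means $S\models B(r)$ implies $S\models H(r)$. $S$ is an answer set of $\Pi$ if $S$ satisfies all rules of $\Pi(S)=\{r\in\Pi\mid S\models B(r)\}$ and no proper subset of $S$ satisfies $\Pi(S)$; answer sets of a non-ground program are those of its grounding. Rules (with variable $X$): (1) $O(X)\vee -O(X)\mathop{{:}- } act(X).$ (2) $F(X)\vee -F(X)\mathop{{:}- } act(X).$ (3) $\mathop{{:}- } O(X), -Dia(X).$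 (4) $-Dia(X)\mathop{{:}- } -Do(X), act(X).$ (5) $\mathop{{:}- } O(X), F(X).$ (6) $Do(X)\vee -Do(X)\mathop{{:}- } act(X).$ (7) $\mathop{{:}- } F(X), Do(X).$ (8) $Happens(X)\mathop{{:}- } Do(X).$ (9) $\mathop{{:}- } Do(X), -Dia(X).$ Here $O(a)$: $a$ is obligatory; $F(a)$: $a$ is forbidden; $Do(a)$/$-Do(a)$: the agent takes/does not take action $a$. A set of deontic literals for $a$ is consistent if it does not contain both $O(a)$ and $F(a)$, it contains $Do(a)$ whenever it contains $O(a)$, and it contains $-Do(a)$ whenever it contains $F(a)$; it is maximal if it contains exactly one of $p(a),-p(a)$ for each $p\in\{O,F,Do\}$. -}

module Defs where

open import Data.Bool using (Bool; true; false; not; _∧_; _∨_; if_then_else_)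
open import Data.List using (List; []; _∷_; concatMap)
open import Data.List.Relation.Unary.All using (All)
open import Data.List.Relation.Unary.Any using (Any)
open import Data.List.Membership.Propositional using (_∈_)
open import Data.Product using (_×_; Σ; ∃; ∃-syntax)
open import Relation.Binary.PropositionalEquality using (_≡_)
open import Relation.Nullary using (¬_)

data Pred : Set where
  act O F Dia Do Happens : Pred

data Const : Set where
  a : Const

allConsts : List Const
allConsts = a ∷ []

record Atom : Set where
  constructor _⟨_⟩
  field
    pred : Pred
    arg  : Const

-- ground literals: atoms or strongly negated atoms -p
data Lit : Set where
  pos : Atom → Lit
  neg : Atom → Lit

-- H₁ ∨ … ∨ Hₗ :- A₁,…,Aₙ, not B₁,…,not Bₘ
record Rule : Set where
  constructor rule
  field
    head    : List Lit
    bodyPos : List Lit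
    bodyNaf : List Lit
open Rule public

Program : Set
Program = List Rule

LitSet : Set
LitSet = Lit → Bool

_∈ˢ_ : Lit → LitSet → Set
l ∈ˢ S = S l ≡ true

_∉ˢ_ : Lit → LitSet → Set
l ∉ˢ S = S l ≡ false

Consistent : LitSet → Set
Consistent S = ∀ (x : Atom) → ¬ (pos x ∈ˢ S × neg x ∈ˢ S)

_⊨B_ : LitSet → Rule → Set
S ⊨B r = All (λ l → l ∈ˢ S) (bodyPos r) × All (λ l → l ∉ˢ S) (bodyNaf r)

-- S ⊨ H(r)   (false for constraints, whose head is empty)
_⊨H_ : LitSet → Rule → Set
S ⊨H r = Any (λ l → l ∈ˢ S) (head r)

_⊨R_ : LitSet → Rule → Set
S ⊨R r = S ⊨B r → S ⊨H r

-- S' satisfies all rules of the reduct Π(S) = {r ∈ Π | S ⊨ B(r)}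
SatisfiesReduct : Program → LitSet → LitSet → Set
SatisfiesReduct Π S S' = ∀ r → r ∈ Π → S ⊨B r → S' ⊨R r

_⊆ˢ_ : LitSet → LitSet → Set
S' ⊆ˢ S = ∀ l → l ∈ˢ S' → l ∈ˢ S

_⊂ˢ_ : LitSet → LitSet → Set
S' ⊂ˢ S = S' ⊆ˢ S × ∃[ l ] (l ∈ˢ S × l ∉ˢ S')

AnswerSet : Program → LitSet → Set
AnswerSet Π S =
  Consistent S
  × SatisfiesReduct Π S S
  × (∀ S' → S' ⊂ˢ S → ¬ SatisfiesReduct Π S S')

ruleSchemas : List (Const → Rule)
ruleSchemas =
    (λ X → rule (pos (O ⟨ X ⟩) ∷ neg (O ⟨ X ⟩) ∷ []) (pos (act ⟨ X ⟩) ∷ []) [])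
  ∷ (λ X → rule (pos (F ⟨ X ⟩) ∷ neg (F ⟨ X ⟩) ∷ []) (pos (act ⟨ X ⟩) ∷ []) [])
  ∷ (λ X → rule [] (pos (O ⟨ X ⟩) ∷ neg (Dia ⟨ X ⟩) ∷ []) [])
  ∷ (λ X → rule (neg (Dia ⟨ X ⟩) ∷ []) (neg (Do ⟨ X ⟩) ∷ pos (act ⟨ X ⟩) ∷ []) [])
  ∷ (λ X → rule [] (pos (O ⟨ X ⟩) ∷ pos (F ⟨ X ⟩) ∷ []) [])
  ∷ (λ X → rule (pos (Do ⟨ X ⟩) ∷ neg (Do ⟨ X ⟩) ∷ []) (pos (act ⟨ X ⟩) ∷ []) [])
  ∷ (λ X → rule [] (pos (F ⟨ X ⟩) ∷ pos (Do ⟨ X ⟩) ∷ []) [])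
  ∷ (λ X → rule (pos (Happens ⟨ X ⟩) ∷ []) (pos (Do ⟨ X ⟩) ∷ []) [])
  ∷ (λ X → rule [] (pos (Do ⟨ X ⟩) ∷ neg (Dia ⟨ X ⟩) ∷ []) [])
  ∷ []

ground : List (Const → Rule) → Program
ground rs = concatMap (λ c → Data.List.map (λ r → r c) rs) allConsts

P : Program
P = rule (pos (act ⟨ a ⟩) ∷ []) [] [] ∷ ground ruleSchemas

isDeonticPred : Pred → Bool
isDeonticPred O  = true
isDeonticPred F  = true
isDeonticPred Do = true
isDeonticPred _  = false

litPred : Lit → Pred
litPred (pos x) = Atom.pred x
litPred (neg x) = Atom.pred x

restrict : LitSet → LitSet
restrict S l = if isDeonticPred (litPred l) then S l else false

_≐_ : LitSet → LitSet → Set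
S ≐ T = ∀ l → S l ≡ T l

deonticSet : (o -o f -f d -d : Bool) → LitSet
deonticSet o -o f -f d -d (pos (O  ⟨ a ⟩)) = o
deonticSet o -o f -f d -d (neg (O  ⟨ a ⟩)) = -o
deonticSet o -o f -f d -d (pos (F  ⟨ a ⟩)) = f
deonticSet o -o f -f d -d (neg (F  ⟨ a ⟩)) = -f
deonticSet o -o f -f d -d (pos (Do ⟨ a ⟩)) = d
deonticSet o -o f -f d -d (neg (Do ⟨ a ⟩)) = -d
deonticSet o -o f -f d -d _                = false

D₁ : LitSet
D₁ = deonticSet true false false true true false
D₂ : LitSet
D₂ = deonticSet false true true false false true
D₃ : LitSet
D₃ = deonticSet false true false true false true
D₄ : LitSet
D₄ = deonticSet false true false true true false

OneOfFour : LitSet → Set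
OneOfFour T = (T ≐ D₁) Data.Sum.⊎ (T ≐ D₂) Data.Sum.⊎ (T ≐ D₃) Data.Sum.⊎ (T ≐ D₄)
  where import Data.Sum

DeonticFor-a : LitSet → Set
DeonticFor-a T = ∀ l → l ∈ˢ T → Σ Pred (λ p → isDeonticPred p ≡ true
                   × ((l ≡ pos (p ⟨ a ⟩)) Data.Sum.⊎ (l ≡ neg (p ⟨ a ⟩))))
  where import Data.Sum

DeonticConsistent : LitSet → Set
DeonticConsistent T =
  ¬ (pos (O ⟨ a ⟩) ∈ˢ T × pos (F ⟨ a ⟩) ∈ˢ T)
  × (pos (O ⟨ a ⟩) ∈ˢ T → pos (Do ⟨ a ⟩) ∈ˢ T)
  × (pos (F ⟨ a ⟩) ∈ˢ T → neg (Do ⟨ a ⟩) ∈ˢ T)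

DeonticMaximal : LitSet → Set
DeonticMaximal T = ∀ p → isDeonticPred p ≡ true →
  T (pos (p ⟨ a ⟩)) ≡ not (T (neg (p ⟨ a ⟩)))

MaxConsistentDeontic : LitSet → Set
MaxConsistentDeontic T = DeonticFor-a T × DeonticConsistent T × DeonticMaximal T

-- Both sides are governed by the three truth values of O(a), F(a), Do(a).  In an answer
-- set the choice rules (1), (2), (6) make each of O(a), F(a), Do(a) decided, and the
-- constraints encode the deontic conditions: (5) forbids O ∧ F, (7) forbids F ∧ Do, and
-- (4) with (3) force Do whenever O holds.  Conversely, every consistent choice of the
-- three values extends to the answer set adding act(a), Happens(a) iff Do(a), and -Dia(a)
-- iff -Do(a); it is minimal because every rule that built it still fires in any subset
-- satisfying the reduct.
module Submission where

open import Defs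
open import Data.Bool using (Bool; true; false; not)
open import Data.Bool.Properties using (not-involutive; not-¬)
open import Data.Empty using (⊥; ⊥-elim)
open import Data.List using ([]; _∷_)
open import Data.List.Membership.Propositional using (_∈_)
open import Data.List.Relation.Unary.All as All using (All; []; _∷_)
open import Data.List.Relation.Unary.Any using (Any; here; there)
open import Data.List.Relation.Unary.Any.Properties using (¬Any[]; singleton⁻)
open import Data.Product using (_×_; ∃-syntax; _,_; proj₁; proj₂)
open import Data.Sum using (_⊎_; inj₁; inj₂)
open import Function using (_∘_)
open import Function.Bundles using (_⇔_; mk⇔)
open import Relation.Binary.PropositionalEquality using (_≡_; _≢_; refl; sym; trans; cong)
open import Relation.Nullary using (¬_)

pattern _⁺ p = pos (p ⟨ a ⟩)
pattern _⁻ p = neg (p ⟨ a ⟩)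
infix 30 _⁺ _⁻

false≢true : false ≢ true
false≢true ()

complementary : ∀ {x y : Bool} → x ≡ true ⊎ y ≡ true → ¬ (x ≡ true × y ≡ true) → x ≡ not y
complementary {true}  {true}  _ not-both = ⊥-elim (not-both (refl , refl))
complementary {true}  {false} _ _        = refl
complementary {false} {true}  _ _        = refl
complementary {false} {false} (inj₁ ()) _
complementary {false} {false} (inj₂ ()) _

not-flip : ∀ {x y : Bool} → x ≡ not y → y ≡ not x
not-flip {x} {y} x≡¬y = trans (sym (not-involutive y)) (cong not (sym x≡¬y))

forced-choice : ∀ b {x y : Bool} → (x ≡ true → b ≡ true) → (y ≡ true → not b ≡ true) →
                x ≡ true ⊎ y ≡ true → (b ≡ true → x ≡ true) × (not b ≡ true → y ≡ true)
forced-choice true  _   _   (inj₁ x) = (λ _ → x) , λ ()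
forced-choice true  _   y⊆ (inj₂ y) = ⊥-elim (false≢true (y⊆ y))
forced-choice false x⊆ _   (inj₁ x) = ⊥-elim (false≢true (x⊆ x))
forced-choice false _   _   (inj₂ y) = (λ ()) , λ _ → y

∈ˢ-resp-≐ : ∀ {S T l} → S ≐ T → l ∈ˢ S → l ∈ˢ T
∈ˢ-resp-≐ {l = l} S≐T = trans (sym (S≐T l))

≐-sym : ∀ {S T} → S ≐ T → T ≐ S
≐-sym S≐T l = sym (S≐T l)

≐-trans : ∀ {S T U} → S ≐ T → T ≐ U → S ≐ U
≐-trans S≐T T≐U l = trans (S≐T l) (T≐U l)

⊆ˢ⇒¬⊃ˢ : ∀ {S S'} → S ⊆ˢ S' → ¬ (S' ⊂ˢ S)
⊆ˢ⇒¬⊃ˢ S⊆S' (_ , l , l∈S , l∉S') = false≢true (trans (sym l∉S') (S⊆S' l l∈S))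

deonticConsistent-resp-≐ : ∀ {S T} → S ≐ T → DeonticConsistent S → DeonticConsistent T
deonticConsistent-resp-≐ {S} {T} S≐T (¬O∧F , O⇒Do , F⇒¬Do) =
  (λ (O∈ , F∈) → ¬O∧F (to O∈ , to F∈)) , from ∘ O⇒Do ∘ to , from ∘ F⇒¬Do ∘ to
  where
  to : ∀ {l} → l ∈ˢ T → l ∈ˢ S
  to = ∈ˢ-resp-≐ (≐-sym S≐T)
  from : ∀ {l} → l ∈ˢ S → l ∈ˢ T
  from = ∈ˢ-resp-≐ S≐T

maxConsistentDeontic-resp-≐ : ∀ {S T} → S ≐ T → MaxConsistentDeontic S → MaxConsistentDeontic T
maxConsistentDeontic-resp-≐ S≐T (deontic , consistent , maximal) =
    (λ l → deontic l ∘ ∈ˢ-resp-≐ (≐-sym S≐T))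
  , deonticConsistent-resp-≐ S≐T consistent
  , λ p isDeontic → trans (sym (S≐T _)) (trans (maximal p isDeontic) (cong not (S≐T _)))

maximalSet : (o f d : Bool) → LitSet
maximalSet o f d = deonticSet o (not o) f (not f) d (not d)

ConsistentChoice : LitSet → Set
ConsistentChoice T = ∃[ o ] ∃[ f ] ∃[ d ] DeonticConsistent (maximalSet o f d) × T ≐ maximalSet o f d

consistentChoice⇒oneOfFour : ∀ {T} → ConsistentChoice T → OneOfFour T
consistentChoice⇒oneOfFour (true  , true  , _     , (¬O∧F , _) , _) = ⊥-elim (¬O∧F (refl , refl))
consistentChoice⇒oneOfFour (true  , false , true  , _ , T≐)        = inj₁ T≐
consistentChoice⇒oneOfFour (true  , false , false , (_ , O⇒Do , _) , _) = ⊥-elim (false≢true (O⇒Do refl))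
consistentChoice⇒oneOfFour (false , true  , true  , (_ , _ , F⇒¬Do) , _) = ⊥-elim (false≢true (F⇒¬Do refl))
consistentChoice⇒oneOfFour (false , true  , false , _ , T≐)        = inj₂ (inj₁ T≐)
consistentChoice⇒oneOfFour (false , false , false , _ , T≐)        = inj₂ (inj₂ (inj₁ T≐))
consistentChoice⇒oneOfFour (false , false , true  , _ , T≐)        = inj₂ (inj₂ (inj₂ T≐))

oneOfFour⇒consistentChoice : ∀ {T} → OneOfFour T → ConsistentChoice T
oneOfFour⇒consistentChoice (inj₁ T≐) =
  true , false , true , ((λ { (_ , ()) }) , (λ _ → refl) , λ ()) , T≐
oneOfFour⇒consistentChoice (inj₂ (inj₁ T≐)) =
  false , true , false , ((λ { (() , _) }) , (λ ()) , λ _ → refl) , T≐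
oneOfFour⇒consistentChoice (inj₂ (inj₂ (inj₁ T≐))) =
  false , false , false , ((λ { (() , _) }) , (λ ()) , λ ()) , T≐
oneOfFour⇒consistentChoice (inj₂ (inj₂ (inj₂ T≐))) =
  false , false , true , ((λ { (() , _) }) , (λ ()) , λ ()) , T≐

deonticFor-a⇒nonDeontic∉ˢ : ∀ {T} → DeonticFor-a T → ∀ l → isDeonticPred (litPred l) ≡ false → l ∉ˢ T
deonticFor-a⇒nonDeontic∉ˢ {T} deontic l nonDeontic with T l in l∈?T
... | false = refl
... | true with deontic l l∈?T
...   | _ , isDeontic , inj₁ refl = ⊥-elim (false≢true (trans (sym nonDeontic) isDeontic))
...   | _ , isDeontic , inj₂ refl = ⊥-elim (false≢true (trans (sym nonDeontic) isDeontic))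

≐-maximalSet : ∀ {T} → DeonticFor-a T → DeonticMaximal T →
               T ≐ maximalSet (T (O ⁺)) (T (F ⁺)) (T (Do ⁺))
≐-maximalSet _       _         (O ⁺)        = refl
≐-maximalSet _       _         (F ⁺)        = refl
≐-maximalSet _       _         (Do ⁺)       = refl
≐-maximalSet _       maximal   (O ⁻)        = not-flip (maximal O refl)
≐-maximalSet _       maximal   (F ⁻)        = not-flip (maximal F refl)
≐-maximalSet _       maximal   (Do ⁻)       = not-flip (maximal Do refl)
≐-maximalSet deontic _         l@(act ⁺)      = deonticFor-a⇒nonDeontic∉ˢ deontic l refl
≐-maximalSet deontic _         l@(act ⁻)      = deonticFor-a⇒nonDeontic∉ˢ deontic l refl
≐-maximalSet deontic _         l@(Dia ⁺)      = deonticFor-a⇒nonDeontic∉ˢ deontic l refl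
≐-maximalSet deontic _         l@(Dia ⁻)      = deonticFor-a⇒nonDeontic∉ˢ deontic l refl
≐-maximalSet deontic _         l@(Happens ⁺)  = deonticFor-a⇒nonDeontic∉ˢ deontic l refl
≐-maximalSet deontic _         l@(Happens ⁻)  = deonticFor-a⇒nonDeontic∉ˢ deontic l refl

maxConsistentDeontic⇒consistentChoice : ∀ {T} → MaxConsistentDeontic T → ConsistentChoice T
maxConsistentDeontic⇒consistentChoice {T} (deontic , consistent , maximal) =
  _ , _ , _ , deonticConsistent-resp-≐ T≐ consistent , T≐
  where
  T≐ : T ≐ maximalSet (T (O ⁺)) (T (F ⁺)) (T (Do ⁺))
  T≐ = ≐-maximalSet deontic maximal

module _ {Π : Program} {S S' : LitSet} (sat : SatisfiesReduct Π S S') where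

  definite-fires : ∀ {h ps} → rule (h ∷ []) ps [] ∈ Π →
                   All (_∈ˢ S) ps → All (_∈ˢ S') ps → h ∈ˢ S'
  definite-fires r∈Π ps∈S ps∈S' = singleton⁻ (sat _ r∈Π (ps∈S , []) (ps∈S' , []))

  disjunction-fires : ∀ {h₁ h₂ ps} → rule (h₁ ∷ h₂ ∷ []) ps [] ∈ Π →
                      All (_∈ˢ S) ps → All (_∈ˢ S') ps → h₁ ∈ˢ S' ⊎ h₂ ∈ˢ S'
  disjunction-fires r∈Π ps∈S ps∈S' with sat _ r∈Π (ps∈S , []) (ps∈S' , [])
  ... | here h₁∈S'         = inj₁ h₁∈S'
  ... | there (here h₂∈S') = inj₂ h₂∈S'

  constraint-blocks : ∀ {ps} → rule [] ps [] ∈ Π → All (_∈ˢ S) ps → ¬ All (_∈ˢ S') ps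
  constraint-blocks r∈Π ps∈S ps∈S' = ¬Any[] (sat _ r∈Π (ps∈S , []) (ps∈S' , []))

choice : Pred → Rule
choice p = rule (p ⁺ ∷ p ⁻ ∷ []) (act ⁺ ∷ []) []

constraint : Lit → Lit → Rule
constraint l₁ l₂ = rule [] (l₁ ∷ l₂ ∷ []) []

fact∈P : rule (act ⁺ ∷ []) [] [] ∈ P
fact∈P = here refl

rule₁∈P : choice O ∈ P
rule₁∈P = there (here refl)

rule₂∈P : choice F ∈ P
rule₂∈P = there (there (here refl))

rule₃∈P : constraint (O ⁺) (Dia ⁻) ∈ P
rule₃∈P = there (there (there (here refl)))

rule₄∈P : rule (Dia ⁻ ∷ []) (Do ⁻ ∷ act ⁺ ∷ []) [] ∈ P
rule₄∈P = there (there (there (there (here refl))))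

rule₅∈P : constraint (O ⁺) (F ⁺) ∈ P
rule₅∈P = there (there (there (there (there (here refl)))))

rule₆∈P : choice Do ∈ P
rule₆∈P = there (there (there (there (there (there (here refl))))))

rule₇∈P : constraint (F ⁺) (Do ⁺) ∈ P
rule₇∈P = there (there (there (there (there (there (there (here refl)))))))

rule₈∈P : rule (Happens ⁺ ∷ []) (Do ⁺ ∷ []) [] ∈ P
rule₈∈P = there (there (there (there (there (there (there (there (here refl))))))))

restrict-deonticFor-a : ∀ S → DeonticFor-a (restrict S)
restrict-deonticFor-a S (pos (p ⟨ a ⟩)) _ with isDeonticPred p in isDeontic
... | true = p , isDeontic , inj₁ refl
restrict-deonticFor-a S (neg (p ⟨ a ⟩)) _ with isDeonticPred p in isDeontic
... | true = p , isDeontic , inj₂ refl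

answerSet⇒maxConsistentDeontic : ∀ {S} → AnswerSet P S → MaxConsistentDeontic (restrict S)
answerSet⇒maxConsistentDeontic {S} (consistent , sat , _) =
  restrict-deonticFor-a S , (¬O∧F , O⇒Do , F⇒¬Do) , maximal
  where
  act∈S : act ⁺ ∈ˢ S
  act∈S = definite-fires sat fact∈P [] []

  chosen : ∀ {p} → choice p ∈ P → p ⁺ ∈ˢ S ⊎ p ⁻ ∈ˢ S
  chosen r∈P = disjunction-fires sat r∈P (act∈S ∷ []) (act∈S ∷ [])

  blocked : ∀ {l₁ l₂} → constraint l₁ l₂ ∈ P → l₁ ∈ˢ S → l₂ ∈ˢ S → ⊥
  blocked r∈P l₁∈S l₂∈S = constraint-blocks sat r∈P (l₁∈S ∷ l₂∈S ∷ []) (l₁∈S ∷ l₂∈S ∷ [])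

  maximal : DeonticMaximal (restrict S)
  maximal O  _ = complementary (chosen rule₁∈P) (consistent (O ⟨ a ⟩))
  maximal F  _ = complementary (chosen rule₂∈P) (consistent (F ⟨ a ⟩))
  maximal Do _ = complementary (chosen rule₆∈P) (consistent (Do ⟨ a ⟩))
  maximal act     ()
  maximal Dia     ()
  maximal Happens ()

  ¬O∧F : ¬ (O ⁺ ∈ˢ S × F ⁺ ∈ˢ S)
  ¬O∧F (O∈S , F∈S) = blocked rule₅∈P O∈S F∈S

  O⇒Do : O ⁺ ∈ˢ S → Do ⁺ ∈ˢ S
  O⇒Do O∈S with chosen rule₆∈P
  ... | inj₁ Do∈S  = Do∈S
  ... | inj₂ ¬Do∈S = ⊥-elim (blocked rule₃∈P O∈S ¬Dia∈S)
    where
    ¬Dia∈S : Dia ⁻ ∈ˢ S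
    ¬Dia∈S = definite-fires sat rule₄∈P (¬Do∈S ∷ act∈S ∷ []) (¬Do∈S ∷ act∈S ∷ [])

  F⇒¬Do : F ⁺ ∈ˢ S → Do ⁻ ∈ˢ S
  F⇒¬Do F∈S with chosen rule₆∈P
  ... | inj₁ Do∈S  = ⊥-elim (blocked rule₇∈P F∈S Do∈S)
  ... | inj₂ ¬Do∈S = ¬Do∈S

answer : (o f d : Bool) → LitSet
answer o f d (act ⁺)     = true
answer o f d (O ⁺)       = o
answer o f d (O ⁻)       = not o
answer o f d (F ⁺)       = f
answer o f d (F ⁻)       = not f
answer o f d (Do ⁺)      = d
answer o f d (Do ⁻)      = not d
answer o f d (Dia ⁻)     = not d
answer o f d (Happens ⁺) = d
answer o f d _           = false

restrict-answer : ∀ o f d → restrict (answer o f d) ≐ maximalSet o f d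
restrict-answer o f d (act ⁺)     = refl
restrict-answer o f d (act ⁻)     = refl
restrict-answer o f d (O ⁺)       = refl
restrict-answer o f d (O ⁻)       = refl
restrict-answer o f d (F ⁺)       = refl
restrict-answer o f d (F ⁻)       = refl
restrict-answer o f d (Do ⁺)      = refl
restrict-answer o f d (Do ⁻)      = refl
restrict-answer o f d (Dia ⁺)     = refl
restrict-answer o f d (Dia ⁻)     = refl
restrict-answer o f d (Happens ⁺) = refl
restrict-answer o f d (Happens ⁻) = refl

not-both : ∀ b → ¬ (b ≡ true × not b ≡ true)
not-both b (b≡true , ¬b≡true) = not-¬ (sym b≡true) (sym ¬b≡true)

answer-consistent : ∀ o f d → Consistent (answer o f d)
answer-consistent o f d (act ⟨ a ⟩)     (_ , ())
answer-consistent o f d (O ⟨ a ⟩)       = not-both o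
answer-consistent o f d (F ⟨ a ⟩)       = not-both f
answer-consistent o f d (Dia ⟨ a ⟩)     (() , _)
answer-consistent o f d (Do ⟨ a ⟩)      = not-both d
answer-consistent o f d (Happens ⟨ a ⟩) (_ , ())

satisfiesReduct-all : ∀ {Π S S'} → All (λ r → S ⊨B r → S' ⊨R r) Π → SatisfiesReduct Π S S'
satisfiesReduct-all rules r r∈Π = All.lookup rules r∈Π

answer-satisfiesReduct : ∀ o f d → DeonticConsistent (maximalSet o f d) →
                         SatisfiesReduct P (answer o f d) (answer o f d)
answer-satisfiesReduct o f d (¬O∧F , O⇒Do , F⇒¬Do) = satisfiesReduct-all
  ( (λ _ _ → here refl)
  ∷ (λ _ _ → decided o refl refl)
  ∷ (λ _ _ → decided f refl refl)
  ∷ (λ { (O∈ ∷ ¬Dia∈ ∷ [] , _) _ → ⊥-elim (not-both d (O⇒Do O∈ , ¬Dia∈)) })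
  ∷ (λ { (¬Do∈ ∷ _ , _) _ → here ¬Do∈ })
  ∷ (λ { (O∈ ∷ F∈ ∷ [] , _) _ → ⊥-elim (¬O∧F (O∈ , F∈)) })
  ∷ (λ _ _ → decided d refl refl)
  ∷ (λ { (F∈ ∷ Do∈ ∷ [] , _) _ → ⊥-elim (not-both d (Do∈ , F⇒¬Do F∈)) })
  ∷ (λ { (Do∈ ∷ [] , _) _ → here Do∈ })
  ∷ (λ { (Do∈ ∷ ¬Dia∈ ∷ [] , _) _ → ⊥-elim (not-both d (Do∈ , ¬Dia∈)) })
  ∷ [])
  where
  decided : ∀ {S : LitSet} {x y} b → S x ≡ b → S y ≡ not b → Any (_∈ˢ S) (x ∷ y ∷ [])
  decided true  x∈S _   = here x∈S
  decided false _   y∈S = there (here y∈S)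

answer-least : ∀ o f d {S'} → SatisfiesReduct P (answer o f d) S' → S' ⊆ˢ answer o f d →
               answer o f d ⊆ˢ S'
answer-least o f d {S'} sat S'⊆ = covered
  where
  act∈S' : act ⁺ ∈ˢ S'
  act∈S' = definite-fires sat fact∈P [] []

  chosen : ∀ {p} → choice p ∈ P → p ⁺ ∈ˢ S' ⊎ p ⁻ ∈ˢ S'
  chosen r∈P = disjunction-fires sat r∈P (refl ∷ []) (act∈S' ∷ [])

  O-forced : (o ≡ true → O ⁺ ∈ˢ S') × (not o ≡ true → O ⁻ ∈ˢ S')
  O-forced = forced-choice o (S'⊆ (O ⁺)) (S'⊆ (O ⁻)) (chosen rule₁∈P)
  F-forced : (f ≡ true → F ⁺ ∈ˢ S') × (not f ≡ true → F ⁻ ∈ˢ S')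
  F-forced = forced-choice f (S'⊆ (F ⁺)) (S'⊆ (F ⁻)) (chosen rule₂∈P)
  Do-forced : (d ≡ true → Do ⁺ ∈ˢ S') × (not d ≡ true → Do ⁻ ∈ˢ S')
  Do-forced = forced-choice d (S'⊆ (Do ⁺)) (S'⊆ (Do ⁻)) (chosen rule₆∈P)

  covered : answer o f d ⊆ˢ S'
  covered (act ⁺)     _     = act∈S'
  covered (O ⁺)       O∈    = proj₁ O-forced O∈
  covered (O ⁻)       ¬O∈   = proj₂ O-forced ¬O∈
  covered (F ⁺)       F∈    = proj₁ F-forced F∈
  covered (F ⁻)       ¬F∈   = proj₂ F-forced ¬F∈
  covered (Do ⁺)      Do∈   = proj₁ Do-forced Do∈
  covered (Do ⁻)      ¬Do∈  = proj₂ Do-forced ¬Do∈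
  covered (Dia ⁻)     ¬Dia∈ =
    definite-fires sat rule₄∈P (¬Dia∈ ∷ refl ∷ []) (proj₂ Do-forced ¬Dia∈ ∷ act∈S' ∷ [])
  covered (Happens ⁺) Do∈   = definite-fires sat rule₈∈P (Do∈ ∷ []) (proj₁ Do-forced Do∈ ∷ [])
  covered (act ⁻)     ()
  covered (Dia ⁺)     ()
  covered (Happens ⁻) ()

answer-answerSet : ∀ o f d → DeonticConsistent (maximalSet o f d) → AnswerSet P (answer o f d)
answer-answerSet o f d consistent =
    answer-consistent o f d
  , answer-satisfiesReduct o f d consistent
  , λ S' S'⊂ sat → ⊆ˢ⇒¬⊃ˢ (answer-least o f d sat (proj₁ S'⊂)) S'⊂

consistentChoice⇒restrictedAnswerSet : ∀ {T} → ConsistentChoice T →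
                                       ∃[ S ] (AnswerSet P S × restrict S ≐ T)
consistentChoice⇒restrictedAnswerSet (o , f , d , consistent , T≐) =
  answer o f d , answer-answerSet o f d consistent , ≐-trans (restrict-answer o f d) (≐-sym T≐)

consistentChoice⇒maxConsistentDeontic : ∀ {T} → ConsistentChoice T → MaxConsistentDeontic T
consistentChoice⇒maxConsistentDeontic consistentChoice
  with consistentChoice⇒restrictedAnswerSet consistentChoice
... | _ , answerSet , restrict≐T =
  maxConsistentDeontic-resp-≐ restrict≐T (answerSet⇒maxConsistentDeontic answerSet)

proposition2 : (∀ (S : LitSet) → AnswerSet P S → OneOfFour (restrict S))
    × (∀ (T : LitSet) → OneOfFour T → ∃[ S ] (AnswerSet P S × restrict S ≐ T))
    × (∀ (T : LitSet) → MaxConsistentDeontic T ⇔ OneOfFour T)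
proposition2 =
    (λ S → consistentChoice⇒oneOfFour ∘ maxConsistentDeontic⇒consistentChoice
         ∘ answerSet⇒maxConsistentDeontic)
  , (λ T → consistentChoice⇒restrictedAnswerSet ∘ oneOfFour⇒consistentChoice)
  , λ T → mk⇔ (consistentChoice⇒oneOfFour ∘ maxConsistentDeontic⇒consistentChoice)
              (consistentChoice⇒maxConsistentDeontic ∘ oneOfFour⇒consistentChoice)
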